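{- Let $\vec{A}\subseteq\mathbb{Z}^d$ be a VAS, let $\lambda$ be an adapted extractor, let $G=(\vec{Q},T)$ be a witness graph with set of states $\vec{Q}\subseteq\mathbb{N}_I^d$, and let $J$ be the minimal excluding set for $(\lambda,\vec{Q})$. Then for every state $\vec{q}\in\vec{Q}$ there exists a run $\vec{q}\xrightarrow{u}\vec{y}$ such that $\pi_J(\vec{q})\xrightarrow{u}_{\pi_J(G)}\pi_J(\vec{y})$ is a path in $\pi_J(G)$, $|u|\leq\sum_{|I|<n\leq|J|}\lambda_n^{d+1-n}$, and $\vec{y}(j)\geq\lambda_{|J|}$ for every $j\in J$.
   Context: Let $\star$ be a new symbol, $\mathbb{N}_\star=\mathbb{N}\cup\{\star\}$, ordered by the usual order with $z\leq\star$ for all $z$. For $I\subseteq\{1,\ldots,d\}$, $\mathbb{N}_I^d$ is the set of $\vec{c}\in\mathbb{N}_\star^d$ with $\{i\mid\vec{c}(i)=\star\}=I$. For $L\subseteq\{1,\ldots,d\}$, $\pi_L(\vec{c})\in\mathbb{N}_{I\cup L}^d$ agrees with $\vec{c}$ outside $L$ and is $\star$ on $L$. A VAS is a finite $\vec{A}\subseteq\mathbb{Z}^d$, $\|\vec{A}\|_\infty=\max_{\vec{a}\in\vec{A}}\max_i|\vec{a}(i)|$ ($0$ if empty). For $\sigma=\vec{a}_1\cdots\vec{a}_k\in\vec{A}^*$, $|\sigma|=k$, and a run $\vec{x}\xrightarrow{\sigma}\vec{y}$ with $\vec{x},\vec{y}\in\mathbb{N}_I^d$ is a sequence $\vec{c}_0,\ldots,\vec{c}_k\in\mathbb{N}_I^d$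 with $\vec{c}_0=\vec{x}$, $\vec{c}_k=\vec{y}$, $\vec{c}_j=\vec{c}_{j-1}+\pi_I(\vec{a}_j)$ (addition componentwise outside $I$). A subreachability graph is $G=(\vec{Q},T)$ with $\vec{Q}\subseteq\mathbb{N}_I^d$ nonempty finite and $T\subseteq\vec{Q}\times\vec{A}\times\vec{Q}$ a finite set of transitions $(\vec{x},\vec{a},\vec{y})$ with $\vec{x}\xrightarrow{\vec{a}}\vec{y}$; a witness graph is a strongly connected one. $\pi_J(G)=(\{\pi_J(\vec{q})\mid\vec{q}\in\vec{Q}\},\{(\pi_J(\vec{x}),\vec{a},\pi_J(\vec{y}))\mid(\vec{x},\vec{a},\vec{y})\in T\})$; a path $\vec{x}\xrightarrow{\sigma}_H\vec{y}$ in a subreachability graph $H$ is a sequence of transitions $(\vec{c}_{j-1},\vec{a}_j,\vec{c}_j)$ of $H$ with $\vec{c}_0=\vec{x}$, $\vec{c}_k=\vec{y}$. An extractor is a non-increasing sequence $\lambda=(\lambda_n)_{1\leq n\leq d}$ of natural numbers; it is adapted if $\lambda_{n-1}\geq\lambda_n^{d-n+1}\|\vec{A}\|_\infty+\lambda_n$ for every $n\in\{2,\ldots,d\}$. For $\vec{X}\subseteq\mathbb{N}_I^d$, a set $J$ is excluding for $(\lambda,\vec{X})$ if $\vec{x}(i)<\lambda_{|J|+1}$ for every $i\notin J$ and every $\vec{x}\in\vec{X}$ (vacuous when $|J|=d$); excluding sets are closed under intersection and $\{1,\ldots,d\}$ is excluding, so a unique minimal excluding set exists. The condition on $\vec{y}$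 is vacuous when $J=\emptyset$. -}

module Defs where

open import Data.Nat using (ℕ; zero; suc; _+_; _*_; _∸_; _^_; _≤_; _<_; _⊔_; _<ᵇ_)
open import Data.Bool using (if_then_else_)
open import Data.Integer as ℤ using (ℤ; +_; ∣_∣)
open import Data.Fin using (Fin)
open import Data.Fin.Subset using (Subset; _∈_; _∉_; _⊆_; inside; outside)
  renaming (∣_∣ to card)
open import Data.Vec using (Vec; lookup; zipWith; toList)
open import Data.List using (List; []; _∷_; map; foldr)
open import Data.List.Membership.Propositional using () renaming (_∈_ to _∈ₗ_)
open import Data.List.Relation.Unary.All using (All)
open import Data.Product using (Σ; ∃; _×_; _,_)
open import Data.Unit using (⊤)
open import Data.Empty using (⊥)
open import Relation.Binary.PropositionalEquality using (_≡_)
open import Function using (_⇔_)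

data ℕ⋆ : Set where
  nat : ℕ → ℕ⋆
  ⋆   : ℕ⋆

_<⋆_ : ℕ⋆ → ℕ → Set
nat m <⋆ n = m < n
⋆     <⋆ n = ⊥

_≥⋆_ : ℕ⋆ → ℕ → Set
nat m ≥⋆ n = n ≤ m
⋆     ≥⋆ n = ⊤

Conf : ℕ → Set
Conf d = Vec ℕ⋆ d

Vecℤ : ℕ → Set
Vecℤ d = Vec ℤ d

InNI : ∀ {d} → Subset d → Conf d → Set
InNI {d} I c = (i : Fin d) → (lookup c i ≡ ⋆) ⇔ (i ∈ I)

π : ∀ {d} → Subset d → Conf d → Conf d
π L c = zipWith (λ s x → sel s x) L c
  where
  sel : _ → ℕ⋆ → ℕ⋆
  sel inside  x = ⋆
  sel outside x = x

VAS : ℕ → Set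
VAS d = List (Vecℤ d)

normInf : ∀ {d} → VAS d → ℕ
normInf A = foldr (λ a m → foldr (λ z k → ∣ z ∣ ⊔ k) 0 (toList a) ⊔ m) 0 A

-- single coordinate step: x + π_I(a) = y (⋆ + z = ⋆; addition in ℕ otherwise)
data StepAt : ℕ⋆ → ℤ → ℕ⋆ → Set where
  star : ∀ {z} → StepAt ⋆ z ⋆
  num  : ∀ {m n z} → + n ≡ (+ m) ℤ.+ z → StepAt (nat m) z (nat n)

Step : ∀ {d} → Conf d → Vecℤ d → Conf d → Set
Step {d} x a y = (i : Fin d) → StepAt (lookup x i) (lookup a i) (lookup y i)

data Run {d} (I : Subset d) : Conf d → List (Vecℤ d) → Conf d → Set where
  done : ∀ {x} → InNI I x → Run I x [] x
  step : ∀ {x a z σ y} → InNI I x → Step x a z → Run I z σ y → Run I x (a ∷ σ) y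

Trans : ℕ → Set
Trans d = Conf d × Vecℤ d × Conf d

record Graph (d : ℕ) : Set where
  constructor graph
  field
    states : List (Conf d)
    trans  : List (Trans d)
open Graph public

data Path {d} (G : Graph d) : Conf d → List (Vecℤ d) → Conf d → Set where
  [] : ∀ {x} → Path G x [] x
  _∷_ : ∀ {x a z σ y} → (x , a , z) ∈ₗ trans G → Path G z σ y → Path G x (a ∷ σ) y

record IsSubreachabilityGraph {d} (A : VAS d) (I : Subset d) (G : Graph d) : Set where
  field
    nonempty : ∃ λ q → q ∈ₗ states G
    statesNI : All (InNI I) (states G)
    transOK  : ∀ {x a y} → (x , a , y) ∈ₗ trans G →
               x ∈ₗ states G × a ∈ₗ A × y ∈ₗ states G × InNI I x × InNI I y × Step x a y

record IsWitnessGraph {d} (A : VAS d) (I : Subset d) (G : Graph d) : Set where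
  field
    subreach : IsSubreachabilityGraph A I G
    strongly : ∀ {x y} → x ∈ₗ states G → y ∈ₗ states G → ∃ λ σ → Path G x σ y

πG : ∀ {d} → Subset d → Graph d → Graph d
πG J G = graph (map (π J) (states G))
               (map (λ { (x , a , y) → (π J x , a , π J y) }) (trans G))

-- extractors: λ_n for 1 ≤ n ≤ d, given as a function ℕ → ℕ (values outside
-- 1..d are never used)
IsExtractor : ℕ → (ℕ → ℕ) → Set
IsExtractor d λs = ∀ m n → 1 ≤ m → m ≤ n → n ≤ d → λs n ≤ λs m

IsAdapted : ∀ {d} → VAS d → (ℕ → ℕ) → Set
IsAdapted {d} A λs = ∀ n → 2 ≤ n → n ≤ d →
  λs n ^ (d ∸ n + 1) * normInf A + λs n ≤ λs (n ∸ 1)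

Excluding : ∀ {d} → (ℕ → ℕ) → List (Conf d) → Subset d → Set
Excluding {d} λs X J = ∀ (i : Fin d) → i ∉ J → ∀ {x} → x ∈ₗ X →
  lookup x i <⋆ λs (suc (card J))

MinimalExcluding : ∀ {d} → (ℕ → ℕ) → List (Conf d) → Subset d → Set
MinimalExcluding λs X J = Excluding λs X J × (∀ K → Excluding λs X K → J ⊆ K)

sumRange : ℕ → ℕ → (ℕ → ℕ) → ℕ
sumRange a zero    f = 0
sumRange a (suc b) f = if a <ᵇ suc b then sumRange a b f + f (suc b) else 0

-- Grow K from I to J one coordinate at a time, keeping a configuration c that
-- is at least λ_|K| on K and agrees off K with some state of G. While K ≠ J,
-- minimality of J yields a state that is at least μ = λ_{|K|+1} at some
-- coordinate outside K. A path of π_K(G) towards it, cut at the first node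
-- leaving the box "below μ off K" and with its loops erased, has at most
-- μ^(d-|K|) steps; by adaptedness λ_|K| ≥ μ^(d-|K|)‖A‖ + μ, so c can follow it
-- while staying at least μ on K, and gains a new coordinate at least μ. That
-- coordinate lies in J because J is excluding.

module Submission where

open import Defs
open import Data.Nat using (ℕ; zero; suc; _+_; _*_; _∸_; _^_; _≤_; _<_; _⊔_; _<ᵇ_; z≤n; s≤s)
import Data.Nat.Properties as ℕ
open import Data.Integer as ℤ using (ℤ; +_; -[1+_])
open import Data.Integer.Properties using (⊖-≥)
open import Data.Bool using (true; false; T)
open import Data.Fin using (Fin; zero; suc)
open import Data.Fin.Subset using (Subset; Side; inside; outside; _∈_; _∉_; _⊆_; _∪_; ⁅_⁆; ∣_∣)
open import Data.Fin.Subset.Properties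
  using (_∈?_; _⊆?_; ⊆-antisym; drop-∷-⊆; ∪-identityʳ; p⊆q⇒∣p∣≤∣q∣; ∣p∣≤n; ∣⁅x⁆∣≡1; x∈⁅y⁆⇒x≡y; p⊆p∪q; x∈p∪q⁻)
import Data.Fin.Properties as Fin
open import Data.Vec using ([]; _∷_; lookup; toList)
open import Data.Vec.Base using (here; there)
open import Data.Vec.Properties using (≡-dec; []=⇒lookup; lookup⇒[]=)
open import Data.List using (List; []; _∷_; [_]; map; length; foldr; _++_; downFrom; cartesianProductWith)
open import Data.List.Properties using (length-map; length-++; length-downFrom; length-removeAt′)
open import Data.List.Membership.Propositional using (find) renaming (_∈_ to _∈ₗ_)
open import Data.List.Membership.Propositional.Properties
  using (∈-map⁺; ∈-map⁻; ∈-downFrom⁺; ∈-cartesianProductWith⁺)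
open import Data.List.Relation.Unary.Any using (index; _─_) renaming (here to hereₗ; there to thereₗ)
open import Data.List.Relation.Unary.All using (All; []; _∷_; all?) renaming (lookup to All-lookup)
import Data.List.Relation.Unary.All as All
open import Data.List.Relation.Unary.All.Properties using (¬All⇒Any¬; ¬Any⇒All¬)
open import Data.List.Relation.Unary.AllPairs using ([]; _∷_)
open import Data.List.Relation.Unary.Unique.Propositional using (Unique)
import Data.List.Membership.DecPropositional as DecMembership
open import Data.Product using (∃; ∃₂; _×_; _,_; proj₁; proj₂)
open import Data.Sum using (_⊎_; inj₁; inj₂; [_,_]′)
import Data.Sum
open import Data.Empty using (⊥-elim)
open import Data.Unit using (tt)
open import Function using (_∘_; _⇔_; mk⇔; Equivalence)
open import Function.Properties.Equivalence using () renaming (trans to ⇔-trans)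
open import Relation.Nullary using (¬_; Dec; yes; no; contradiction; ¬?; _→-dec_)
open import Relation.Unary using (Decidable)
open import Relation.Binary.PropositionalEquality
  using (_≡_; _≢_; refl; sym; cong; cong₂; subst; subst₂; module ≡-Reasoning) renaming (trans to ≡-trans)

_≟⋆_ : (x y : ℕ⋆) → Dec (x ≡ y)
nat m ≟⋆ nat n with m ℕ.≟ n
... | yes refl = yes refl
... | no m≢n   = no λ { refl → m≢n refl }
nat _ ≟⋆ ⋆     = no λ ()
⋆     ≟⋆ nat _ = no λ ()
⋆     ≟⋆ ⋆     = yes refl

_<⋆?_ : ∀ x μ → Dec (x <⋆ μ)
nat m <⋆? μ = m ℕ.<? μ
⋆     <⋆? μ = no λ ()

<⋆-≤-trans : ∀ x {m n} → x <⋆ m → m ≤ n → x <⋆ n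
<⋆-≤-trans (nat _) = ℕ.<-≤-trans

≥⋆-≤-trans : ∀ x {m n} → x ≥⋆ n → m ≤ n → x ≥⋆ m
≥⋆-≤-trans (nat _) n≤x m≤n = ℕ.≤-trans m≤n n≤x
≥⋆-≤-trans ⋆       _   _   = tt

≮⋆⇒≥⋆ : ∀ x {μ} → ¬ (x <⋆ μ) → x ≥⋆ μ
≮⋆⇒≥⋆ (nat _) = ℕ.≮⇒≥
≮⋆⇒≥⋆ ⋆       _ = tt

-- The absolute value is a junk value unless ∣ b ∣ ≤ m; see stepAt-+⋆.
_+⋆_ : ℕ⋆ → ℤ → ℕ⋆
nat m +⋆ b = nat ℤ.∣ + m ℤ.+ b ∣
⋆     +⋆ _ = ⋆

+⋆≡⋆⇔ : ∀ x b → (x +⋆ b ≡ ⋆) ⇔ (x ≡ ⋆)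
+⋆≡⋆⇔ (nat _) _ = mk⇔ (λ ()) (λ ())
+⋆≡⋆⇔ ⋆       _ = mk⇔ (λ _ → refl) (λ _ → refl)

stepAt-+⋆ : ∀ x b → x ≥⋆ ℤ.∣ b ∣ → StepAt x b (x +⋆ b)
stepAt-+⋆ ⋆       _        _   = star
stepAt-+⋆ (nat m) (+ _)    _   = num refl
stepAt-+⋆ (nat m) -[1+ k ] k<m = num (≡-trans (cong (+_ ∘ ℤ.∣_∣) m⊖k) (sym m⊖k))
  where m⊖k = ⊖-≥ k<m

+⋆-≥⋆ : ∀ x b {n B} → x ≥⋆ (n + B) → ℤ.∣ b ∣ ≤ n → (x +⋆ b) ≥⋆ B
+⋆-≥⋆ ⋆       _        _     _   = tt
+⋆-≥⋆ (nat m) (+ k)    {n} x≥ _ = ℕ.≤-trans (ℕ.m+n≤o⇒n≤o n x≥) (ℕ.m≤m+n m k)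
+⋆-≥⋆ (nat m) -[1+ k ] {n} {B} x≥ k<n rewrite ⊖-≥ (ℕ.≤-trans k<n (ℕ.m+n≤o⇒m≤o n x≥)) =
  ℕ.m+n≤o⇒m≤o∸n B (ℕ.≤-trans (ℕ.+-monoʳ-≤ B k<n) (ℕ.≤-trans (ℕ.≤-reflexive (ℕ.+-comm B n)) x≥))

π-∈ : ∀ {d} {K : Subset d} {i} (c : Conf d) → i ∈ K → lookup (π K c) i ≡ ⋆
π-∈ (_ ∷ _) here        = refl
π-∈ (_ ∷ c) (there i∈K) = π-∈ c i∈K

π-∉ : ∀ {d} {K : Subset d} {i} (c : Conf d) → i ∉ K → lookup (π K c) i ≡ lookup c i
π-∉ {K = inside  ∷ _} {zero}  _       i∉K = contradiction here i∉K
π-∉ {K = outside ∷ _} {zero}  (_ ∷ _) _   = refl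
π-∉ {K = _       ∷ _} {suc _} (_ ∷ c) i∉K = π-∉ c (i∉K ∘ there)

π-agree : ∀ {d} {K : Subset d} {c c' : Conf d} {i} → π K c ≡ π K c' → i ∉ K → lookup c i ≡ lookup c' i
π-agree {c = c} {c'} {i} eq i∉K =
  ≡-trans (sym (π-∉ c i∉K)) (≡-trans (cong (λ v → lookup v i) eq) (π-∉ c' i∉K))

π-absorb : ∀ {d} {K J : Subset d} → K ⊆ J → (c : Conf d) → π J (π K c) ≡ π J c
π-absorb {K = []}          {[]}          _   []      = refl
π-absorb {K = _       ∷ _} {inside  ∷ _} K⊆J (_ ∷ c) = cong (⋆ ∷_) (π-absorb (drop-∷-⊆ K⊆J) c)
π-absorb {K = outside ∷ _} {outside ∷ _} K⊆J (x ∷ c) = cong (x ∷_) (π-absorb (drop-∷-⊆ K⊆J) c)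
π-absorb {K = inside  ∷ _} {outside ∷ _} K⊆J _       with K⊆J here
... | ()

π-cong-⊆ : ∀ {d} {K J : Subset d} → K ⊆ J → {c c' : Conf d} → π K c ≡ π K c' → π J c ≡ π J c'
π-cong-⊆ K⊆J {c} {c'} eq =
  ≡-trans (sym (π-absorb K⊆J c)) (≡-trans (cong (π _) eq) (π-absorb K⊆J c'))

∣p∪⁅x⁆∣≡1+∣p∣ : ∀ {n} {p : Subset n} {x} → x ∉ p → ∣ p ∪ ⁅ x ⁆ ∣ ≡ suc ∣ p ∣
∣p∪⁅x⁆∣≡1+∣p∣ {p = inside  ∷ _} {zero}  x∉p = contradiction here x∉p
∣p∪⁅x⁆∣≡1+∣p∣ {p = outside ∷ p} {zero}  _   = cong (suc ∘ ∣_∣) (∪-identityʳ p)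
∣p∪⁅x⁆∣≡1+∣p∣ {p = inside  ∷ _} {suc _} x∉p = cong suc (∣p∪⁅x⁆∣≡1+∣p∣ (x∉p ∘ there))
∣p∪⁅x⁆∣≡1+∣p∣ {p = outside ∷ _} {suc _} x∉p = ∣p∪⁅x⁆∣≡1+∣p∣ (x∉p ∘ there)

x∉p⇒∣p∣<n : ∀ {n} {p : Subset n} {x} → x ∉ p → ∣ p ∣ < n
x∉p⇒∣p∣<n {p = p} {x} x∉p = ℕ.≤-trans (ℕ.≤-reflexive (sym (∣p∪⁅x⁆∣≡1+∣p∣ x∉p))) (∣p∣≤n (p ∪ ⁅ x ⁆))

x∈p⇒0<∣p∣ : ∀ {n} {p : Subset n} {x} → x ∈ p → 0 < ∣ p ∣
x∈p⇒0<∣p∣ {x = x} x∈p = ℕ.≤-trans (ℕ.≤-reflexive (sym (∣⁅x⁆∣≡1 x)))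
  (p⊆q⇒∣p∣≤∣q∣ (λ y∈⁅x⁆ → subst (_∈ _) (sym (x∈⁅y⁆⇒x≡y x y∈⁅x⁆)) x∈p))

sumRange-≥ : ∀ {a b} f → b ≤ a → sumRange a b f ≡ 0
sumRange-≥ {b = zero}  _ _   = refl
sumRange-≥ {a} {suc b} _ b<a with a <ᵇ suc b in a<ᵇb
... | true  = contradiction (ℕ.<ᵇ⇒< a (suc b) (subst T (sym a<ᵇb) tt)) (ℕ.≤⇒≯ b<a)
... | false = refl

sumRange-suc : ∀ {a b} f → a < suc b → sumRange a (suc b) f ≡ sumRange a b f + f (suc b)
sumRange-suc {a} {b} _ a<b with a <ᵇ suc b | ℕ.<⇒<ᵇ a<b
... | true | _ = refl

sumRange-split : ∀ {a b} f → a < b → sumRange a b f ≡ f (suc a) + sumRange (suc a) b f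
sumRange-split {a} {suc b} f (s≤s a≤b) with ℕ.m≤n⇒m<n∨m≡n a≤b
... | inj₂ refl = begin
  sumRange a (suc a) f                   ≡⟨ sumRange-suc f (ℕ.n<1+n a) ⟩
  sumRange a a f + f (suc a)             ≡⟨ cong (_+ f (suc a)) (sumRange-≥ {a} f ℕ.≤-refl) ⟩
  f (suc a)                              ≡⟨ sym (ℕ.+-identityʳ _) ⟩
  f (suc a) + 0                          ≡⟨ cong (_+_ (f (suc a))) (sym (sumRange-≥ {suc a} f ℕ.≤-refl)) ⟩
  f (suc a) + sumRange (suc a) (suc a) f ∎
  where open ≡-Reasoning
... | inj₁ a<b = begin
  sumRange a (suc b) f                           ≡⟨ sumRange-suc f (ℕ.m<n⇒m<1+n a<b) ⟩
  sumRange a b f + f (suc b)                     ≡⟨ cong (_+ f (suc b)) (sumRange-split f a<b) ⟩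
  f (suc a) + sumRange (suc a) b f + f (suc b)   ≡⟨ ℕ.+-assoc (f (suc a)) _ _ ⟩
  f (suc a) + (sumRange (suc a) b f + f (suc b)) ≡⟨ cong (_+_ (f (suc a))) (sym (sumRange-suc f (s≤s a<b))) ⟩
  f (suc a) + sumRange (suc a) (suc b) f         ∎
  where open ≡-Reasoning

length-cartesianProductWith : ∀ {A B C : Set} (f : A → B → C) xs ys →
  length (cartesianProductWith f xs ys) ≡ length xs * length ys
length-cartesianProductWith f []       ys = refl
length-cartesianProductWith f (x ∷ xs) ys =
  ≡-trans (length-++ (map (f x) ys))
          (cong₂ _+_ (length-map (f x) ys) (length-cartesianProductWith f xs ys))

InBox : ℕ → Side → ℕ⋆ → Set
InBox μ inside  v = v ≡ ⋆
InBox μ outside v = v <⋆ μ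

Boxed : ∀ {n} → Subset n → ℕ → Conf n → Set
Boxed K μ v = ∀ i → InBox μ (lookup K i) (lookup v i)

boxed? : ∀ {n} (K : Subset n) μ → Decidable (Boxed K μ)
boxed? K μ v = Fin.all? (λ i → inBox? (lookup K i) (lookup v i))
  where
  inBox? : ∀ s x → Dec (InBox μ s x)
  inBox? inside  x = x ≟⋆ ⋆
  inBox? outside x = x <⋆? μ

box : ∀ {n} → Subset n → ℕ → List (Conf n)
box []            _ = [ [] ]
box (inside  ∷ K) μ = map (⋆ ∷_) (box K μ)
box (outside ∷ K) μ = cartesianProductWith _∷_ (map nat (downFrom μ)) (box K μ)

length-box : ∀ {n} (K : Subset n) μ → length (box K μ) ≡ μ ^ (n ∸ ∣ K ∣)
length-box []            μ = refl
length-box (inside  ∷ K) μ = ≡-trans (length-map (⋆ ∷_) (box K μ)) (length-box K μ)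
length-box {suc n} (outside ∷ K) μ = begin
  length (cartesianProductWith _∷_ (map nat (downFrom μ)) (box K μ))
    ≡⟨ length-cartesianProductWith _∷_ (map nat (downFrom μ)) (box K μ) ⟩
  length (map nat (downFrom μ)) * length (box K μ)
    ≡⟨ cong₂ _*_ (≡-trans (length-map nat (downFrom μ)) (length-downFrom μ)) (length-box K μ) ⟩
  μ ^ suc (n ∸ ∣ K ∣)
    ≡⟨ cong (μ ^_) (sym (ℕ.+-∸-assoc 1 (∣p∣≤n K))) ⟩
  μ ^ (suc n ∸ ∣ K ∣) ∎
  where open ≡-Reasoning

∈-box : ∀ {n} (K : Subset n) μ {v} → Boxed K μ v → v ∈ₗ box K μ
∈-box []            _ {[]}        _ = hereₗ refl
∈-box (inside  ∷ K) μ {_ ∷ _}     b with b zero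
... | refl = ∈-map⁺ (⋆ ∷_) (∈-box K μ (b ∘ suc))
∈-box (outside ∷ K) μ {nat _ ∷ _} b =
  ∈-cartesianProductWith⁺ _∷_ (∈-map⁺ nat (∈-downFrom⁺ (b zero))) (∈-box K μ (b ∘ suc))
∈-box (outside ∷ K) μ {⋆ ∷ _}     b = ⊥-elim (b zero)

lookup≡outside⇒∉ : ∀ {n} {K : Subset n} {i} → lookup K i ≡ outside → i ∉ K
lookup≡outside⇒∉ eq i∈K with ≡-trans (sym ([]=⇒lookup i∈K)) eq
... | ()

boxed-∉ : ∀ {n} {K : Subset n} {μ v i} → Boxed K μ v → i ∉ K → lookup v i <⋆ μ
boxed-∉ {K = K} {i = i} b i∉K with lookup K i in eq | b i
... | inside  | _    = contradiction (lookup⇒[]= i K eq) i∉K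
... | outside | v<μ = v<μ

π-boxed : ∀ {n} {K : Subset n} {μ} w → (∀ i → i ∉ K → lookup w i <⋆ μ) → Boxed K μ (π K w)
π-boxed {K = K} {μ} w small i with lookup K i in eq
... | inside  = π-∈ w (lookup⇒[]= i K eq)
... | outside = subst (_<⋆ μ) (sym (π-∉ {K = K} w (lookup≡outside⇒∉ eq))) (small i (lookup≡outside⇒∉ eq))

¬boxed-π⇒∃ : ∀ {n} {K : Subset n} {μ} w → ¬ Boxed K μ (π K w) → ∃ λ i → i ∉ K × ¬ (lookup w i <⋆ μ)
¬boxed-π⇒∃ {n} {K} {μ} w unboxed with Fin.¬∀⟶∃¬ n _ small? (unboxed ∘ π-boxed w)
  where small? = λ i → ¬? (i ∈? K) →-dec (lookup w i <⋆? μ)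
... | i , ¬small = i , (λ i∈K → ¬small (contradiction i∈K)) , (λ w<μ → ¬small (λ _ → w<μ))

∈-─ : ∀ {A : Set} {x y : A} {ys} (x∈ys : x ∈ₗ ys) → y ∈ₗ ys → x ≢ y → y ∈ₗ (ys ─ x∈ys)
∈-─ (hereₗ refl) (hereₗ refl) x≢y = contradiction refl x≢y
∈-─ (hereₗ refl) (thereₗ y∈ys) _  = y∈ys
∈-─ (thereₗ _)   (hereₗ refl) _   = hereₗ refl
∈-─ (thereₗ x∈ys) (thereₗ y∈ys) x≢y = thereₗ (∈-─ x∈ys y∈ys x≢y)

unique⇒length≤ : ∀ {A : Set} {xs ys : List A} → Unique xs → All (_∈ₗ ys) xs → length xs ≤ length ys
unique⇒length≤ []                  []                = z≤n
unique⇒length≤ {ys = ys} (x∉xs ∷ u) (x∈ys ∷ xs⊆ys) =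
  ℕ.≤-trans (s≤s (unique⇒length≤ u (All.zipWith (λ (y∈ys , x≢y) → ∈-─ x∈ys y∈ys x≢y) (xs⊆ys , x∉xs))))
            (ℕ.≤-reflexive (sym (length-removeAt′ ys (index x∈ys))))

module _ {d : ℕ} where

  _++ᴾ_ : ∀ {H : Graph d} {x σ z τ y} → Path H x σ z → Path H z τ y → Path H x (σ ++ τ) y
  []      ++ᴾ q = q
  (e ∷ p) ++ᴾ q = e ∷ (p ++ᴾ q)

  map-Path : ∀ {H H' : Graph d} (f : Conf d → Conf d) →
    (∀ {x a z} → (x , a , z) ∈ₗ trans H → (f x , a , f z) ∈ₗ trans H') →
    ∀ {x σ y} → Path H x σ y → Path H' (f x) σ (f y)
  map-Path f f-trans []      = []
  map-Path f f-trans (e ∷ p) = f-trans e ∷ map-Path f f-trans p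

  sources : ∀ {H : Graph d} {x σ y} → Path H x σ y → List (Conf d)
  sources         []      = []
  sources {x = x} (_ ∷ p) = x ∷ sources p

  length-sources : ∀ {H : Graph d} {x σ y} (p : Path H x σ y) → length (sources p) ≡ length σ
  length-sources []      = refl
  length-sources (_ ∷ p) = cong suc (length-sources p)

  _++ᴿ_ : ∀ {I : Subset d} {x σ z τ y} → Run I x σ z → Run I z τ y → Run I x (σ ++ τ) y
  done _       ++ᴿ r' = r'
  step x∈I s r ++ᴿ r' = step x∈I s (r ++ᴿ r')

  Run-target : ∀ {I : Subset d} {x σ y} → Run I x σ y → InNI I y
  Run-target (done y∈I)   = y∈I
  Run-target (step _ _ r) = Run-target r

  module _ {G : Graph d} where

    πG-trans⁺ : ∀ {K x a z} → (x , a , z) ∈ₗ trans G → (π K x , a , π K z) ∈ₗ trans (πG K G)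
    πG-trans⁺ = ∈-map⁺ _

    πG-trans⁻ : ∀ {K p a t} → (p , a , t) ∈ₗ trans (πG K G) →
      ∃₂ λ x z → (x , a , z) ∈ₗ trans G × π K x ≡ p × π K z ≡ t
    πG-trans⁻ e with ∈-map⁻ _ e
    ... | (x , _ , z) , xaz∈G , refl = x , z , xaz∈G , refl , refl

    πG-path : ∀ {K x σ y} → Path G x σ y → Path (πG K G) (π K x) σ (π K y)
    πG-path {K} = map-Path (π K) πG-trans⁺

    πG-path-⊆ : ∀ {K J} → K ⊆ J → ∀ {p σ t} → Path (πG K G) p σ t → Path (πG J G) (π J p) σ (π J t)
    πG-path-⊆ {K} {J} K⊆J = map-Path (π J) lift
      where
      lift : ∀ {p a t} → (p , a , t) ∈ₗ trans (πG K G) → (π J p , a , π J t) ∈ₗ trans (πG J G)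
      lift e with πG-trans⁻ e
      ... | x , z , xaz∈G , refl , refl rewrite π-absorb K⊆J x | π-absorb K⊆J z = πG-trans⁺ xaz∈G

module LoopErasure {d} (H : Graph d) {P : Conf d → Set} (P? : Decidable P) where

  open DecMembership (≡-dec {n = d} _≟⋆_) using () renaming (_∈?_ to _∈ₗ?_)

  record Escape (x : Conf d) : Set where
    constructor escape
    field
      {word}         : List (Vecℤ d)
      {exit}         : Conf d
      path           : Path H x word exit
      exit-¬P        : ¬ P exit
      sources-unique : Unique (sources path)
      sources-P      : All P (sources path)

  suffix : ∀ {z x} (esc : Escape z) → x ∈ₗ sources (Escape.path esc) → Escape x
  suffix (escape (e ∷ p) ¬Py u       a)       (hereₗ refl) = escape (e ∷ p) ¬Py u a
  suffix (escape (_ ∷ p) ¬Py (_ ∷ u) (_ ∷ a)) (thereₗ x∈)  = suffix (escape p ¬Py u a) x∈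

  escape-from : ∀ {x σ y} → Path H x σ y → ¬ P y → Escape x
  escape-from []              ¬Py = escape [] ¬Py [] []
  escape-from {x} (e ∷ p) ¬Py with P? x
  ... | no ¬Px = escape [] ¬Px [] []
  ... | yes Px with escape-from p ¬Py
  ...   | esc@(escape q ¬Pz u a) with x ∈ₗ? sources q
  ...     | yes x∈ = suffix esc x∈
  ...     | no  x∉ = escape (e ∷ q) ¬Pz (¬Any⇒All¬ _ x∉ ∷ u) (Px ∷ a)

  escape-length : ∀ {x} {E : List (Conf d)} → (∀ {v} → P v → v ∈ₗ E) → (esc : Escape x) →
    length (Escape.word esc) ≤ length E
  escape-length P⊆E (escape p _ u a) =
    ℕ.≤-trans (ℕ.≤-reflexive (sym (length-sources p))) (unique⇒length≤ u (All.map P⊆E a))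

rowNorm : ∀ {d} → Vecℤ d → ℕ
rowNorm a = foldr (λ z k → ℤ.∣ z ∣ ⊔ k) 0 (toList a)

∣lookup∣≤rowNorm : ∀ {d} (a : Vecℤ d) i → ℤ.∣ lookup a i ∣ ≤ rowNorm a
∣lookup∣≤rowNorm (b ∷ _) zero    = ℕ.m≤m⊔n ℤ.∣ b ∣ _
∣lookup∣≤rowNorm (b ∷ a) (suc i) = ℕ.≤-trans (∣lookup∣≤rowNorm a i) (ℕ.m≤n⊔m ℤ.∣ b ∣ _)

∣lookup∣≤normInf : ∀ {d} {A : VAS d} {a} → a ∈ₗ A → ∀ i → ℤ.∣ lookup a i ∣ ≤ normInf A
∣lookup∣≤normInf {A = a ∷ _} (hereₗ refl) i = ℕ.≤-trans (∣lookup∣≤rowNorm a i) (ℕ.m≤m⊔n (rowNorm a) _)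
∣lookup∣≤normInf {A = a ∷ _} (thereₗ a∈A) i = ℕ.≤-trans (∣lookup∣≤normInf a∈A i) (ℕ.m≤n⊔m (rowNorm a) _)

LargeOn : ∀ {d} → Subset d → ℕ → Conf d → Set
LargeOn K B c = ∀ k → k ∈ K → lookup c k ≥⋆ B

LargeOn-≤ : ∀ {d} {K : Subset d} {B B' c} → B ≤ B' → LargeOn K B' c → LargeOn K B c
LargeOn-≤ {c = c} B≤B' large k k∈K = ≥⋆-≤-trans (lookup c k) (large k k∈K) B≤B'

-- On K, c takes the step a; off K, where c agrees with the source x of a
-- transition x -a→ z of G, it copies z.
shadow : ∀ {n} → Subset n → Conf n → Vecℤ n → Conf n → Conf n
shadow []            []      []      []      = []
shadow (inside  ∷ K) (x ∷ c) (b ∷ a) (_ ∷ z) = x +⋆ b ∷ shadow K c a z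
shadow (outside ∷ K) (_ ∷ c) (_ ∷ a) (w ∷ z) = w ∷ shadow K c a z

module _ {n} {K : Subset n} {c : Conf n} {a : Vecℤ n} {z : Conf n} where

  shadow-∈ : ∀ {i} → i ∈ K → lookup (shadow K c a z) i ≡ lookup c i +⋆ lookup a i
  shadow-∈ = go K c a z
    where
    go : ∀ {n} (K : Subset n) c a z {i} → i ∈ K → lookup (shadow K c a z) i ≡ lookup c i +⋆ lookup a i
    go (inside  ∷ K) (_ ∷ c) (_ ∷ a) (_ ∷ z) here        = refl
    go (inside  ∷ K) (_ ∷ c) (_ ∷ a) (_ ∷ z) (there i∈K) = go K c a z i∈K
    go (outside ∷ K) (_ ∷ c) (_ ∷ a) (_ ∷ z) (there i∈K) = go K c a z i∈K

  shadow-∉ : ∀ {i} → i ∉ K → lookup (shadow K c a z) i ≡ lookup z i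
  shadow-∉ = go K c a z _
    where
    go : ∀ {n} (K : Subset n) c a z i → i ∉ K → lookup (shadow K c a z) i ≡ lookup z i
    go (inside  ∷ K) (_ ∷ c) (_ ∷ a) (_ ∷ z) zero    i∉K = contradiction here i∉K
    go (outside ∷ K) (_ ∷ c) (_ ∷ a) (_ ∷ z) zero    _   = refl
    go (inside  ∷ K) (_ ∷ c) (_ ∷ a) (_ ∷ z) (suc i) i∉K = go K c a z i (i∉K ∘ there)
    go (outside ∷ K) (_ ∷ c) (_ ∷ a) (_ ∷ z) (suc i) i∉K = go K c a z i (i∉K ∘ there)

  π-shadow : π K (shadow K c a z) ≡ π K z
  π-shadow = go K c a z
    where
    go : ∀ {n} (K : Subset n) c a z → π K (shadow K c a z) ≡ π K z
    go []            []      []      []      = refl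
    go (inside  ∷ K) (_ ∷ c) (_ ∷ a) (_ ∷ z) = cong (⋆ ∷_) (go K c a z)
    go (outside ∷ K) (_ ∷ c) (_ ∷ a) (w ∷ z) = cong (w ∷_) (go K c a z)

  shadow-step : ∀ {x} → Step x a z → π K c ≡ π K x → (∀ i → i ∈ K → lookup c i ≥⋆ ℤ.∣ lookup a i ∣) →
    Step c a (shadow K c a z)
  shadow-step st agree c-large i with i ∈? K
  ... | yes i∈K rewrite shadow-∈ i∈K = stepAt-+⋆ (lookup c i) (lookup a i) (c-large i i∈K)
  ... | no  i∉K rewrite shadow-∉ i∉K | π-agree agree i∉K = st i

  shadow-InNI : ∀ {I} → InNI I c → InNI I z → InNI I (shadow K c a z)
  shadow-InNI c∈I z∈I i with i ∈? K
  ... | yes i∈K rewrite shadow-∈ i∈K = ⇔-trans (+⋆≡⋆⇔ (lookup c i) (lookup a i)) (c∈I i)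
  ... | no  i∉K rewrite shadow-∉ i∉K = z∈I i

  shadow-large : ∀ {m B} → LargeOn K (m + B) c → (∀ i → ℤ.∣ lookup a i ∣ ≤ m) → LargeOn K B (shadow K c a z)
  shadow-large c-large a≤m k k∈K rewrite shadow-∈ k∈K = +⋆-≥⋆ (lookup c k) (lookup a k) (c-large k k∈K) (a≤m k)

module Subreachability {d} {A : VAS d} {I : Subset d} {G : Graph d} (G-sub : IsSubreachabilityGraph A I G) where

  open IsSubreachabilityGraph G-sub

  N : ℕ
  N = normInf A

  πG-word∈A : ∀ {K p σ t} → Path (πG K G) p σ t → All (_∈ₗ A) σ
  πG-word∈A         []      = []
  πG-word∈A {K = K} (e ∷ p) with πG-trans⁻ {G = G} {K = K} e
  ... | _ , _ , xaz∈G , _ = proj₁ (proj₂ (transOK xaz∈G)) ∷ πG-word∈A {K = K} p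

  πG-path-target : ∀ {K s p σ t} → s ∈ₗ states G → π K s ≡ p → Path (πG K G) p σ t →
    ∃ λ w → w ∈ₗ states G × π K w ≡ t
  πG-path-target         s∈Q eq []      = _ , s∈Q , eq
  πG-path-target {K = K} s∈Q _  (e ∷ p) with πG-trans⁻ {G = G} {K = K} e
  ... | _ , _ , xaz∈G , _ , refl = πG-path-target {K = K} (proj₁ (proj₂ (proj₂ (transOK xaz∈G)))) refl p

  shadow-run : ∀ {K μ p σ t} → Path (πG K G) p σ t → ∀ {c} → InNI I c → π K c ≡ p →
    LargeOn K (length σ * N + μ) c → ∃ λ y → Run I c σ y × π K y ≡ t × LargeOn K μ y
  shadow-run []                 {c} c∈I eq c-large = c , done c∈I , eq , c-large
  shadow-run {K} {μ} {σ = a ∷ σ} (e ∷ p) {c} c∈I eq c-large with πG-trans⁻ {G = G} {K = K} e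
  ... | x , z , xaz∈G , refl , refl with transOK xaz∈G
  ... | _ , a∈A , _ , _ , z∈I , x→z =
    let y , run , πy , y-large =
          shadow-run {K} p (shadow-InNI {K = K} c∈I z∈I) (π-shadow {c = c} {a})
                     (shadow-large {z = z} c-large′ (∣lookup∣≤normInf a∈A))
    in y , step c∈I c→c′ run , πy , y-large
    where
    c-large′ : LargeOn K (N + (length σ * N + μ)) c
    c-large′ = LargeOn-≤ {K = K} {c = c} (ℕ.≤-reflexive (sym (ℕ.+-assoc N (length σ * N) μ))) c-large
    c→c′ : Step c a (shadow K c a z)
    c→c′ = shadow-step {K = K} x→z eq λ i i∈K →
      ≥⋆-≤-trans (lookup c i) (c-large′ i i∈K) (ℕ.≤-trans (∣lookup∣≤normInf a∈A i) (ℕ.m≤m+n N _))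

¬excluding⇒∃ : ∀ {d} λs (X : List (Conf d)) K → ¬ Excluding λs X K →
  ∃₂ λ i x → i ∉ K × x ∈ₗ X × ¬ (lookup x i <⋆ λs (suc ∣ K ∣))
¬excluding⇒∃ {d} λs X K ¬excl with Fin.¬∀⟶∃¬ d _ bounded? (¬excl ∘ λ b i i∉K → All-lookup (b i i∉K))
  where bounded? = λ i → ¬? (i ∈? K) →-dec all? (λ x → lookup x i <⋆? λs (suc ∣ K ∣)) X
... | i , ¬bounded with find (¬All⇒Any¬ (λ x → lookup x i <⋆? λs (suc ∣ K ∣)) X (λ b → ¬bounded (λ _ → b)))
... | x , x∈X , x-large = i , x , (λ i∈K → ¬bounded (contradiction i∈K)) , x∈X , x-large

m∸[1+n]+1≡m∸n : ∀ {m n} → n < m → m ∸ suc n + 1 ≡ m ∸ n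
m∸[1+n]+1≡m∸n {m} {n} n<m = ≡-trans (ℕ.+-comm (m ∸ suc n) 1) (sym (ℕ.+-∸-assoc 1 n<m))

module Extraction {d} (A : VAS d) (λs : ℕ → ℕ) (I : Subset d) (G : Graph d) (J : Subset d)
  (extractor : IsExtractor d λs) (adapted : IsAdapted A λs) (G-witness : IsWitnessGraph A I G)
  (J-minimal : MinimalExcluding λs (states G) J) where

  open IsWitnessGraph G-witness
  open IsSubreachabilityGraph subreach
  open Subreachability subreach

  Q : List (Conf d)
  Q = states G

  threshold : Subset d → ℕ
  threshold K = λs (suc ∣ K ∣)

  bound : ℕ → ℕ
  bound n = λs n ^ (d + 1 ∸ n)

  record Stage (K : Subset d) (c : Conf d) : Set where
    constructor stage
    field
      K⊆J      : K ⊆ J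
      c∈I      : InNI I c
      {anchor} : Conf d
      anchor∈Q : anchor ∈ₗ Q
      π-anchor : π K anchor ≡ π K c
      c-large  : LargeOn K (λs ∣ K ∣) c

  ∣K∣≤∣J∣ : ∀ {K c} → Stage K c → ∣ K ∣ ≤ ∣ J ∣
  ∣K∣≤∣J∣ = p⊆q⇒∣p∣≤∣q∣ ∘ Stage.K⊆J

  record Segment (c y : Conf d) (B : ℕ) : Set where
    constructor segment
    field
      {word} : List (Vecℤ d)
      run    : Run I c word y
      path   : Path (πG J G) (π J c) word (π J y)
      short  : length word ≤ B

  _++ˢ_ : ∀ {c z y B B'} → Segment c z B → Segment z y B' → Segment c y (B + B')
  segment {u} r p s ++ˢ segment r' p' s' =
    segment (r ++ᴿ r') (p ++ᴾ p') (ℕ.≤-trans (ℕ.≤-reflexive (length-++ u)) (ℕ.+-mono-≤ s s'))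

  Segment-≤ : ∀ {c y B B'} → B ≤ B' → Segment c y B → Segment c y B'
  Segment-≤ B≤B' (segment r p s) = segment r p (ℕ.≤-trans s B≤B')

  record Exit (K : Subset d) (c : Conf d) : Set where
    field
      {word}   : List (Vecℤ d)
      {target} : Conf d
      path     : Path (πG K G) (π K c) word (π K target)
      target∈Q : target ∈ₗ Q
      {coord}  : Fin d
      coord∉K  : coord ∉ K
      coord-≮  : ¬ (lookup target coord <⋆ threshold K)
      short    : length word ≤ threshold K ^ (d ∸ ∣ K ∣)

  module _ {K : Subset d} where
    open LoopErasure (πG K G) (boxed? K (threshold K))

    exit-of-escape : ∀ {c s} → s ∈ₗ Q → π K s ≡ π K c → Escape (π K c) → Exit K c
    exit-of-escape s∈Q π-s esc@(escape p exit-unboxed _ _) with πG-path-target s∈Q π-s p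
    ... | w , w∈Q , refl with ¬boxed-π⇒∃ w exit-unboxed
    ... | i , i∉K , w-large = record
      { path     = p
      ; target∈Q = w∈Q
      ; coord∉K  = i∉K
      ; coord-≮  = w-large
      ; short    = subst (_ ≤_) (length-box K (threshold K)) (escape-length (∈-box K (threshold K)) esc)
      }

    exit-towards : ∀ {c} → Stage K c → ∀ {i x} → i ∉ K → x ∈ₗ Q → ¬ (lookup x i <⋆ threshold K) → Exit K c
    exit-towards {c} (stage _ _ anchor∈Q π-anchor _) {i} {x} i∉K x∈Q x-large =
      exit-of-escape anchor∈Q π-anchor (escape-from to-x x-unboxed)
      where
      to-x : Path (πG K G) (π K c) _ (π K x)
      to-x = subst (λ p → Path (πG K G) p _ _) π-anchor (πG-path (proj₂ (strongly anchor∈Q x∈Q)))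
      x-unboxed : ¬ Boxed K (threshold K) (π K x)
      x-unboxed b = x-large (subst (_<⋆ threshold K) (π-∉ x i∉K) (boxed-∉ {v = π K x} b i∉K))

  find-exit : ∀ {K c} → Stage K c → ¬ (J ⊆ K) → Exit K c
  find-exit {K} st J⊈K with ¬excluding⇒∃ λs Q K (J⊈K ∘ proj₂ J-minimal K)
  ... | _ , _ , i∉K , x∈Q , x-large = exit-towards st i∉K x∈Q x-large

  coord∈J : ∀ {K c} → Stage K c → (ex : Exit K c) → Exit.coord ex ∈ J
  coord∈J {K} st ex with Exit.coord ex ∈? J
  ... | yes i∈J = i∈J
  ... | no  i∉J = contradiction
    (<⋆-≤-trans (lookup target coord) (proj₁ J-minimal coord i∉J target∈Q)
      (extractor (suc ∣ K ∣) (suc ∣ J ∣) (s≤s z≤n) (s≤s (∣K∣≤∣J∣ st)) (x∉p⇒∣p∣<n i∉J)))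
    coord-≮
    where open Exit ex

  budget : ∀ {K c} → Stage K c → (ex : Exit K c) → LargeOn K (length (Exit.word ex) * N + threshold K) c
  budget {K} st ex k k∈K = ≥⋆-≤-trans _ (Stage.c-large st k k∈K) (begin
    length word * N + μ                      ≤⟨ ℕ.+-monoˡ-≤ μ (ℕ.*-monoˡ-≤ N short) ⟩
    μ ^ (d ∸ ∣ K ∣) * N + μ                  ≡⟨ cong (λ e → μ ^ e * N + μ) (sym (m∸[1+n]+1≡m∸n ∣K∣<d)) ⟩
    μ ^ (d ∸ suc ∣ K ∣ + 1) * N + μ          ≤⟨ adapted (suc ∣ K ∣) (s≤s (x∈p⇒0<∣p∣ k∈K)) ∣K∣<d ⟩
    λs ∣ K ∣                                 ∎)
    where
    open Exit ex
    open ℕ.≤-Reasoning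
    μ = threshold K
    ∣K∣<d = x∉p⇒∣p∣<n coord∉K

  advance-along : ∀ {K c} → Stage K c → (ex : Exit K c) →
    ∃ λ y → Stage (K ∪ ⁅ Exit.coord ex ⁆) y × Segment c y (bound (suc ∣ K ∣))
  advance-along {K} {c} st ex with shadow-run {K} (Exit.path ex) (Stage.c∈I st) refl (budget st ex)
  ... | y , run , πy , y-large = y , next , segment run path-J short-J
    where
    open Exit ex
    open Stage st using (K⊆J)
    K' = K ∪ ⁅ coord ⁆
    ∈K'⁻ : ∀ {k} → k ∈ K' → k ∈ K ⊎ k ≡ coord
    ∈K'⁻ k∈K' = Data.Sum.map₂ (x∈⁅y⁆⇒x≡y coord) (x∈p∪q⁻ K ⁅ coord ⁆ k∈K')
    coord-large : lookup y coord ≥⋆ threshold K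
    coord-large = subst (_≥⋆ threshold K) (sym (π-agree πy coord∉K)) (≮⋆⇒≥⋆ (lookup target coord) coord-≮)
    K'-large : LargeOn K' (λs ∣ K' ∣) y
    K'-large k k∈K' rewrite ∣p∪⁅x⁆∣≡1+∣p∣ coord∉K =
      [ y-large k , (λ { refl → coord-large }) ]′ (∈K'⁻ k∈K')
    next : Stage K' y
    next = stage ([ K⊆J , (λ { refl → coord∈J st ex }) ]′ ∘ ∈K'⁻) (Run-target run) target∈Q
                 (π-cong-⊆ (p⊆p∪q ⁅ coord ⁆) (sym πy)) K'-large
    path-J : Path (πG J G) (π J c) word (π J y)
    path-J = subst₂ (λ p t → Path (πG J G) p word t)
                    (π-absorb K⊆J c) (≡-trans (cong (π J) (sym πy)) (π-absorb K⊆J y)) (πG-path-⊆ K⊆J path)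
    short-J : length word ≤ bound (suc ∣ K ∣)
    short-J = subst (λ e → length word ≤ threshold K ^ e) (cong (_∸ suc ∣ K ∣) (ℕ.+-comm 1 d)) short

  advance : ∀ {K c} → Stage K c → ¬ (J ⊆ K) →
    ∃₂ λ K' y → ∣ K' ∣ ≡ suc ∣ K ∣ × Stage K' y × Segment c y (bound (suc ∣ K ∣))
  advance st J⊈K =
    let ex = find-exit st J⊈K
        y , st' , seg = advance-along st ex
    in _ , y , ∣p∪⁅x⁆∣≡1+∣p∣ (Exit.coord∉K ex) , st' , seg

  Extracted : Subset d → Conf d → Set
  Extracted K c = ∃ λ y → Segment c y (sumRange (∣ K ∣) (∣ J ∣) bound) × LargeOn J (λs ∣ J ∣) y

  extract : ∀ n {K c} → n + ∣ K ∣ ≡ ∣ J ∣ → Stage K c → Extracted K c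
  extract-after : ∀ n {K c} → n + ∣ K ∣ ≡ ∣ J ∣ →
    (∃₂ λ K' y → ∣ K' ∣ ≡ suc ∣ K ∣ × Stage K' y × Segment c y (bound (suc ∣ K ∣))) → Extracted K c

  extract n {K} {c} n+K≡J st with J ⊆? K
  ... | no  J⊈K = extract-after n {K} n+K≡J (advance st J⊈K)
  ... | yes J⊆K with ⊆-antisym (Stage.K⊆J st) J⊆K
  ...   | refl = c , segment (done (Stage.c∈I st)) [] z≤n , Stage.c-large st

  extract-after zero      n+K≡J (_ , _ , ∣K'∣≡ , st' , _) =
    contradiction (subst (_≤ ∣ J ∣) ∣K'∣≡ (∣K∣≤∣J∣ st')) (ℕ.<-irrefl n+K≡J)
  extract-after (suc n) {K} n+K≡J (K' , y , ∣K'∣≡ , st' , seg) =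
    let z , seg' , z-large = extract n (≡-trans (cong (_+_ n) ∣K'∣≡) (≡-trans (ℕ.+-suc n ∣ K ∣) n+K≡J)) st'
    in z , Segment-≤ (ℕ.≤-reflexive total) (seg ++ˢ seg') , z-large
    where
    progress : ∣ K ∣ < ∣ J ∣
    progress = subst (_≤ ∣ J ∣) ∣K'∣≡ (∣K∣≤∣J∣ st')
    total : bound (suc ∣ K ∣) + sumRange (∣ K' ∣) (∣ J ∣) bound ≡ sumRange (∣ K ∣) (∣ J ∣) bound
    total = ≡-trans (cong (λ k → bound (suc ∣ K ∣) + sumRange k (∣ J ∣) bound) ∣K'∣≡)
                    (sym (sumRange-split bound progress))

  I⊆J : ∀ {q} → q ∈ₗ Q → I ⊆ J
  I⊆J q∈Q {k} k∈I with k ∈? J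
  ... | yes k∈J = k∈J
  ... | no  k∉J = ⊥-elim (subst (_<⋆ threshold J) (Equivalence.from (All-lookup statesNI q∈Q k) k∈I)
                                (proj₁ J-minimal k k∉J q∈Q))

  initial : ∀ {q} → q ∈ₗ Q → Stage I q
  initial q∈Q = stage (I⊆J q∈Q) q∈I q∈Q refl
    (λ k k∈I → subst (_≥⋆ λs ∣ I ∣) (sym (Equivalence.from (q∈I k) k∈I)) tt)
    where q∈I = All-lookup statesNI q∈Q

  extraction : ∀ {q} → q ∈ₗ Q → Extracted I q
  extraction q∈Q = extract (∣ J ∣ ∸ ∣ I ∣) (ℕ.m∸n+n≡m (p⊆q⇒∣p∣≤∣q∣ (I⊆J q∈Q))) (initial q∈Q)

lemma9p2 : ∀ {d} (A : VAS d) (λs : ℕ → ℕ) (I : Subset d) (G : Graph d) (J : Subset d) →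
    IsExtractor d λs → IsAdapted A λs →
    IsWitnessGraph A I G →
    MinimalExcluding λs (states G) J →
    ∀ {q} → q ∈ₗ states G →
    ∃₂ λ (u : List (Vecℤ d)) (y : Conf d) →
      All (_∈ₗ A) u ×
      Run I q u y ×
      Path (πG J G) (π J q) u (π J y) ×
      length u ≤ sumRange ∣ I ∣ ∣ J ∣ (λ n → λs n ^ (d + 1 ∸ n)) ×
      (∀ (j : Fin d) → j ∈ J → lookup y j ≥⋆ λs ∣ J ∣)
lemma9p2 A λs I G J extractor adapted G-witness J-minimal q∈Q
  with Extraction.extraction A λs I G J extractor adapted G-witness J-minimal q∈Q
... | y , Extraction.segment run path short , y-large =
  _ , y , Subreachability.πG-word∈A (IsWitnessGraph.subreach G-witness) path , run , path , short , y-large
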